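{- Let $n\ge2$ and let $G=\mathcal{K}_n$ be the complete graph on $n$ vertices. Then $1\in V_G(2)$ if and only if the equation $\sum_{i=1}^n \frac{1}{y_i}+\frac{1}{y_1\cdots y_n}=1$ has a solution in integers $y_1,\dots,y_n\ge3$.
   Context: For a graph $G$ with vertices $v_1,\dots,v_n$ and adjacency matrix $A_G$, $M_G(a_1,\dots,a_n)=\mathrm{Diag}(a_1,\dots,a_n)-A_G$. For $M\in M_n(\mathbb{Z})$, $\Phi_M$ is the torsion subgroup of $\mathbb{Z}^n/\mathrm{Im}(M)$. A symmetric integer matrix $B$ is positive definite (resp. semi-definite) if ${}^tXBX>0$ (resp. $\ge0$) for all nonzero integer $X$. $V_G(r)$ is the set of $u\in\mathbb{Z}_{\ge0}$ for which there exist integers $a_1,\dots,a_n\ge r$ with $u=\det M_G(a_1,\dots,a_n)$, $M_G(a_1,\dots,a_n)$ positive definite if $u\ne0$ and positive semi-definite of rank $n-1$ if $u=0$, and $\Phi_{M_G(a_1,\dots,a_n)}$ cyclic. -}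

module Defs where

open import Data.Nat as ℕ using (ℕ; zero; suc)
open import Data.Fin using (Fin; zero; suc; punchIn; _≟_)
open import Data.Integer as ℤ using (ℤ; +_; -[1+_])
open import Data.Rational as ℚ using (ℚ)
open import Data.Product using (Σ; ∃; _×_; _,_)
open import Relation.Binary.PropositionalEquality using (_≡_)
open import Relation.Nullary using (¬_; yes; no)

Matrix : ℕ → Set
Matrix n = Fin n → Fin n → ℤ

Vecℤ : ℕ → Set
Vecℤ n = Fin n → ℤ

sumℤ : (n : ℕ) → (Fin n → ℤ) → ℤ
sumℤ zero    f = + 0
sumℤ (suc n) f = f zero ℤ.+ sumℤ n (λ i → f (suc i))

prodℤ : (n : ℕ) → (Fin n → ℤ) → ℤ
prodℤ zero    f = + 1
prodℤ (suc n) f = f zero ℤ.* prodℤ n (λ i → f (suc i))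

sumℚ : (n : ℕ) → (Fin n → ℚ) → ℚ
sumℚ zero    f = ℚ.0ℚ
sumℚ (suc n) f = f zero ℚ.+ sumℚ n (λ i → f (suc i))

minor : {n : ℕ} → Matrix (suc n) → Fin (suc n) → Fin (suc n) → Matrix n
minor M i j a b = M (punchIn i a) (punchIn j b)

sign : ℕ → ℤ
sign zero          = + 1
sign (suc zero)    = -[1+ 0 ]
sign (suc (suc k)) = sign k

det : (n : ℕ) → Matrix n → ℤ
det zero    M = + 1
det (suc n) M =
  sumℤ (suc n) (λ j → sign (Data.Fin.toℕ j) ℤ.* (M zero j ℤ.* det n (minor M zero j)))

Diag : {n : ℕ} → Vecℤ n → Matrix n
Diag a i j with i ≟ j
... | yes _ = a i
... | no  _ = + 0

_−ᴹ_ : {n : ℕ} → Matrix n → Matrix n → Matrix n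
(A −ᴹ B) i j = A i j ℤ.- B i j

completeAdj : (n : ℕ) → Matrix n
completeAdj n i j with i ≟ j
... | yes _ = + 0
... | no  _ = + 1

MG : {n : ℕ} → Matrix n → Vecℤ n → Matrix n
MG A a = Diag a −ᴹ A

quad : {n : ℕ} → Matrix n → Vecℤ n → ℤ
quad {n} B X = sumℤ n (λ i → sumℤ n (λ j → X i ℤ.* (B i j ℤ.* X j)))

NonZeroVec : {n : ℕ} → Vecℤ n → Set
NonZeroVec X = ∃ λ i → ¬ (X i ≡ + 0)

PosDef : {n : ℕ} → Matrix n → Set
PosDef B = ∀ X → NonZeroVec X → + 0 ℤ.< quad B X

PosSemiDef : {n : ℕ} → Matrix n → Set
PosSemiDef B = ∀ X → + 0 ℤ.≤ quad B X

-- (determinantal) rank equal to n - 1 for a matrix of size n ≥ 1: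
-- the determinant vanishes and some (n-1)x(n-1) minor does not.
-- For n = 0 the rank n - 1 is impossible.
RankPred : (n : ℕ) → Matrix n → Set
RankPred zero    M = Data.Empty.⊥ where import Data.Empty
RankPred (suc n) M = det (suc n) M ≡ + 0 × ∃ λ i → ∃ λ j → ¬ (det n (minor M i j) ≡ + 0)

_·_ : {n : ℕ} → Matrix n → Vecℤ n → Vecℤ n
_·_ {n} M Y i = sumℤ n (λ j → M i j ℤ.* Y j)

InImage : {n : ℕ} → Matrix n → Vecℤ n → Set
InImage M x = ∃ λ Y → ∀ i → x i ≡ (M · Y) i

Torsion : {n : ℕ} → Matrix n → Vecℤ n → Set
Torsion M x = ∃ λ k → ¬ (k ≡ + 0) × InImage M (λ i → k ℤ.* x i)

-- Φ_M (torsion subgroup of Z^n / Im M) is cyclic: generated by the class of one torsion element g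
CyclicΦ : {n : ℕ} → Matrix n → Set
CyclicΦ M = ∃ λ g → Torsion M g ×
  (∀ x → Torsion M x → ∃ λ m → InImage M (λ i → x i ℤ.- m ℤ.* g i))

-- u ∈ V_G(r), G given by its adjacency matrix A
InV : {n : ℕ} → Matrix n → ℤ → ℕ → Set
InV {n} A r u = ∃ λ (a : Vecℤ n) → (∀ i → r ℤ.≤ a i) ×
  (+ u ≡ det n (MG A a)) × Cond u (MG A a) × CyclicΦ (MG A a)
  where
  Cond : ℕ → Matrix n → Set
  Cond zero    M = PosSemiDef M × RankPred n M
  Cond (suc _) M = PosDef M

-- reciprocal of an integer (1/0 := 0, never used below since y_i ≥ 3)
recip : ℤ → ℚ
recip (+ zero)  = ℚ.0ℚ
recip (+ suc k) = + 1 ℚ./ suc k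
recip -[1+ k ]  = -[1+ 0 ] ℚ./ suc k

{-# OPTIONS --safe #-}
-- Put y = a + 1. Then M_{K_n}(a) = Diag(y) − J with J the all-ones matrix, and
-- det (Diag(y) − J) = ∏ y − Σᵢ ∏_{j≠i} yⱼ = ∏ y · (1 − Σ 1/yᵢ), so for positive yᵢ the
-- condition det = 1 is exactly the equation Σ 1/yᵢ + 1/∏ y = 1, while a ≥ 2 means y ≥ 3.
-- Conversely, when det = 1 we have Σ 1/yᵢ < 1, and weighted Cauchy–Schwarz,
-- (Σ Xᵢ)² ≤ (Σ 1/yᵢ)(Σ yᵢXᵢ²), makes Diag(y) − J positive definite; being unimodular
-- it maps ℤⁿ onto itself, so ℤⁿ/Im M is trivial and Φ_M is cyclic.
module Submission where

open import Defs
open import Data.Bool using (if_then_else_)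
open import Data.Empty using (⊥-elim)
open import Data.Fin as F using (Fin; zero; suc; punchIn; punchOut; toℕ; inject₁)
open import Data.Fin.Properties
  using (suc-injective; punchIn-injective; punchInᵢ≢i; punchIn-punchOut; toℕ-injective; toℕ<n; toℕ-inject₁; toℕ-fromℕ<)
open import Data.Integer as ℤ using (ℤ; +_; 0ℤ; 1ℤ; -1ℤ; _+_; _*_; -_; _-_; +≤+; +<+) renaming (_≤_ to _≤ℤ_; _<_ to _<ℤ_)
import Data.Integer.Properties as ℤP
open import Data.Integer.Tactic.RingSolver using (solve-∀)
open import Data.Nat as ℕ using (ℕ; zero; suc; _≤_; z≤n; s≤s)
import Data.Nat.Properties as ℕP
open import Data.Product using (∃; _×_; _,_)
open import Data.Rational as ℚ using (ℚ; 1ℚ; toℚᵘ) renaming (_+_ to _+ℚ_)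
import Data.Rational.Properties as ℚP
open import Data.Rational.Solver using (module +-*-Solver)
open import Data.Rational.Unnormalised as ℚᵘ using (mkℚᵘ; *≡*)
import Data.Rational.Unnormalised.Properties as ℚᵘP
open import Data.Sum using (_⊎_; inj₁; inj₂)
open import Function using (_∘_)
open import Function.Bundles using (_⇔_; mk⇔; Equivalence)
import Function.Properties.Equivalence as ⇔
open import Relation.Binary.PropositionalEquality
open import Relation.Nullary using (yes; no; does)
open import Relation.Nullary.Decidable using (dec-true; dec-false)

open import Algebra.Properties.Semiring.Sum ℤP.+-*-semiring as Sum using (sum)
open +-*-Solver using (solve; _:+_; _:*_; _:=_)

sumℤ≡sum : ∀ n (f : Vecℤ n) → sumℤ n f ≡ sum f
sumℤ≡sum zero    f = refl
sumℤ≡sum (suc n) f = cong (λ s → f zero + s) (sumℤ≡sum n (f ∘ suc))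

sumℤ-cong : ∀ n {f g : Vecℤ n} → (∀ i → f i ≡ g i) → sumℤ n f ≡ sumℤ n g
sumℤ-cong n {f} {g} f≗g =
  trans (sumℤ≡sum n f) (trans (Sum.sum-cong-≗ f≗g) (sym (sumℤ≡sum n g)))

sumℤ-distrib-+ : ∀ n (f g : Vecℤ n) → sumℤ n (λ i → f i + g i) ≡ sumℤ n f + sumℤ n g
sumℤ-distrib-+ n f g = begin
  sumℤ n (λ i → f i + g i)  ≡⟨ sumℤ≡sum n _ ⟩
  sum (λ i → f i + g i)     ≡⟨ Sum.∑-distrib-+ f g ⟩
  sum f + sum g             ≡⟨ sym (cong₂ _+_ (sumℤ≡sum n f) (sumℤ≡sum n g)) ⟩
  sumℤ n f + sumℤ n g       ∎
  where open ≡-Reasoning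

*-distribˡ-sumℤ : ∀ n c (f : Vecℤ n) → c * sumℤ n f ≡ sumℤ n (λ i → c * f i)
*-distribˡ-sumℤ n c f = begin
  c * sumℤ n f             ≡⟨ cong (c *_) (sumℤ≡sum n f) ⟩
  c * sum f                ≡⟨ Sum.*-distribˡ-sum c f ⟩
  sum (λ i → c * f i)      ≡⟨ sym (sumℤ≡sum n _) ⟩
  sumℤ n (λ i → c * f i)   ∎
  where open ≡-Reasoning

neg-distrib-sumℤ : ∀ n (f : Vecℤ n) → - sumℤ n f ≡ sumℤ n (λ i → - f i)
neg-distrib-sumℤ n f = begin
  - sumℤ n f                  ≡⟨ sym (ℤP.-1*i≡-i _) ⟩
  -1ℤ * sumℤ n f              ≡⟨ *-distribˡ-sumℤ n -1ℤ f ⟩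
  sumℤ n (λ i → -1ℤ * f i)    ≡⟨ sumℤ-cong n (ℤP.-1*i≡-i ∘ f) ⟩
  sumℤ n (λ i → - f i)        ∎
  where open ≡-Reasoning

sumℤ-zero : ∀ n (f : Vecℤ n) → (∀ i → f i ≡ 0ℤ) → sumℤ n f ≡ 0ℤ
sumℤ-zero zero    f f≡0 = refl
sumℤ-zero (suc n) f f≡0 = cong₂ _+_ (f≡0 zero) (sumℤ-zero n (f ∘ suc) (f≡0 ∘ suc))

sumℤ-single : ∀ n (f : Vecℤ n) c → (∀ j → j ≢ c → f j ≡ 0ℤ) → sumℤ n f ≡ f c
sumℤ-single (suc n) f zero    f≡0 =
  trans (cong (λ s → f zero + s) (sumℤ-zero n (f ∘ suc) (λ j → f≡0 (suc j) λ ()))) (ℤP.+-identityʳ _)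
sumℤ-single (suc n) f (suc c) f≡0 =
  trans (cong₂ _+_ (f≡0 zero λ ()) (sumℤ-single n (f ∘ suc) c (λ j j≢c → f≡0 (suc j) (j≢c ∘ suc-injective))))
        (ℤP.+-identityˡ _)

sumℤ-pair : ∀ n (f : Vecℤ n) c d → c ≢ d → (∀ j → j ≢ c → j ≢ d → f j ≡ 0ℤ) → sumℤ n f ≡ f c + f d
sumℤ-pair (suc n) f zero    zero    c≢d f≡0 = ⊥-elim (c≢d refl)
sumℤ-pair (suc n) f zero    (suc d) c≢d f≡0 =
  cong (λ s → f zero + s) (sumℤ-single n (f ∘ suc) d (λ j j≢d → f≡0 (suc j) (λ ()) (j≢d ∘ suc-injective)))
sumℤ-pair (suc n) f (suc c) zero    c≢d f≡0 =
  trans (cong (λ s → f zero + s) (sumℤ-single n (f ∘ suc) c (λ j j≢c → f≡0 (suc j) (j≢c ∘ suc-injective) (λ ()))))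
        (ℤP.+-comm (f zero) (f (suc c)))
sumℤ-pair (suc n) f (suc c) (suc d) c≢d f≡0 =
  trans (cong₂ _+_ (f≡0 zero (λ ()) (λ ()))
                   (sumℤ-pair n (f ∘ suc) c d (c≢d ∘ cong suc)
                      (λ j j≢c j≢d → f≡0 (suc j) (j≢c ∘ suc-injective) (j≢d ∘ suc-injective))))
        (ℤP.+-identityˡ _)

sumℤ-nonNeg : ∀ n (f : Vecℤ n) → (∀ i → 0ℤ ≤ℤ f i) → 0ℤ ≤ℤ sumℤ n f
sumℤ-nonNeg zero    f f≥0 = +≤+ z≤n
sumℤ-nonNeg (suc n) f f≥0 = ℤP.+-mono-≤ (f≥0 zero) (sumℤ-nonNeg n (f ∘ suc) (f≥0 ∘ suc))

sumℤ-pos : ∀ n (f : Vecℤ n) c → (∀ i → 0ℤ ≤ℤ f i) → 0ℤ <ℤ f c → 0ℤ <ℤ sumℤ n f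
sumℤ-pos (suc n) f zero    f≥0 fc>0 = ℤP.+-mono-<-≤ fc>0 (sumℤ-nonNeg n (f ∘ suc) (f≥0 ∘ suc))
sumℤ-pos (suc n) f (suc c) f≥0 fc>0 = ℤP.+-mono-≤-< (f≥0 zero) (sumℤ-pos n (f ∘ suc) c (f≥0 ∘ suc) fc>0)

prodℤ-cong : ∀ n {f g : Vecℤ n} → (∀ i → f i ≡ g i) → prodℤ n f ≡ prodℤ n g
prodℤ-cong zero    f≗g = refl
prodℤ-cong (suc n) f≗g = cong₂ _*_ (f≗g zero) (prodℤ-cong n (f≗g ∘ suc))

square-nonNeg : ∀ x → 0ℤ ≤ℤ x * x
square-nonNeg (+ n)    = subst (0ℤ ≤ℤ_) (ℤP.pos-* n n) (+≤+ z≤n)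
square-nonNeg ℤ.-[1+ n ] = +≤+ z≤n

square-pos : ∀ {x} → x ≢ 0ℤ → 0ℤ <ℤ x * x
square-pos {ℤ.+ zero}    x≢0 = ⊥-elim (x≢0 refl)
square-pos {ℤ.+[1+ n ]}  _   = +<+ (s≤s z≤n)
square-pos {ℤ.-[1+ n ]}  _   = +<+ (s≤s z≤n)

*-nonNeg : ∀ {a b} → 0ℤ ≤ℤ a → 0ℤ ≤ℤ b → 0ℤ ≤ℤ a * b
*-nonNeg {a} {b} a≥0 b≥0 = subst (_≤ℤ a * b) (ℤP.*-zeroʳ a) (ℤP.*-monoˡ-≤-nonNeg a {{ℤ.nonNegative a≥0}} b≥0)

*-pos : ∀ {a b} → 0ℤ <ℤ a → 0ℤ <ℤ b → 0ℤ <ℤ a * b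
*-pos {a} {b} a>0 b>0 = subst (_<ℤ a * b) (ℤP.*-zeroʳ a) (ℤP.*-monoˡ-<-pos a {{ℤ.positive a>0}} b>0)

prodℤ-pos : ∀ n (f : Vecℤ n) → (∀ i → 0ℤ <ℤ f i) → 0ℤ <ℤ prodℤ n f
prodℤ-pos zero    f f>0 = +<+ (s≤s z≤n)
prodℤ-pos (suc n) f f>0 = *-pos (f>0 zero) (prodℤ-pos n (f ∘ suc) (f>0 ∘ suc))

sumℤ-weighted-square-shift : ∀ n (w z : Vecℤ n) c →
  sumℤ n (λ i → w i * ((z i - c) * (z i - c))) ≡
  sumℤ n (λ i → w i * (z i * z i)) - (c + c) * sumℤ n (λ i → w i * z i) + c * c * sumℤ n w
sumℤ-weighted-square-shift zero    w z c = l c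
  where l : ∀ c → 0ℤ ≡ 0ℤ - (c + c) * 0ℤ + c * c * 0ℤ
        l = solve-∀
sumℤ-weighted-square-shift (suc n) w z c =
  trans (cong (λ t → w zero * ((z zero - c) * (z zero - c)) + t) (sumℤ-weighted-square-shift n (w ∘ suc) (z ∘ suc) c))
        (l (w zero) (z zero) c _ _ _)
  where l : ∀ w₀ z₀ c A L W → w₀ * ((z₀ - c) * (z₀ - c)) + (A - (c + c) * L + c * c * W) ≡
                               w₀ * (z₀ * z₀) + A - (c + c) * (w₀ * z₀ + L) + c * c * (w₀ + W)
        l = solve-∀

weighted-cauchy-schwarz : ∀ n (w z : Vecℤ n) → (∀ i → 0ℤ ≤ℤ w i) →
  sumℤ n (λ i → w i * z i) * sumℤ n (λ i → w i * z i) ≤ℤ sumℤ n w * sumℤ n (λ i → w i * (z i * z i))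
weighted-cauchy-schwarz n w z w≥0 = ℤP.0≤i-j⇒j≤i (gap n w z w≥0)
  where
  gap : ∀ n (w z : Vecℤ n) → (∀ i → 0ℤ ≤ℤ w i) →
    0ℤ ≤ℤ sumℤ n w * sumℤ n (λ i → w i * (z i * z i)) - sumℤ n (λ i → w i * z i) * sumℤ n (λ i → w i * z i)
  gap zero    w z w≥0 = +≤+ z≤n
  gap (suc n) w z w≥0 = subst (0ℤ ≤ℤ_) (l (w zero) (z zero) W A L)
    (ℤP.+-mono-≤ (gap n (w ∘ suc) (z ∘ suc) (w≥0 ∘ suc))
      (*-nonNeg (w≥0 zero) (subst (0ℤ ≤ℤ_) (sumℤ-weighted-square-shift n (w ∘ suc) (z ∘ suc) (z zero))
        (sumℤ-nonNeg n _ (λ i → *-nonNeg (w≥0 (suc i)) (square-nonNeg (z (suc i) - z zero)))))))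
    where
    W = sumℤ n (w ∘ suc)
    A = sumℤ n (λ i → w (suc i) * (z (suc i) * z (suc i)))
    L = sumℤ n (λ i → w (suc i) * z (suc i))
    l : ∀ w₀ z₀ W A L → (W * A - L * L) + w₀ * (A - (z₀ + z₀) * L + z₀ * z₀ * W) ≡
                        (w₀ + W) * (w₀ * (z₀ * z₀) + A) - (w₀ * z₀ + L) * (w₀ * z₀ + L)
    l = solve-∀

laplaceTerm : ∀ {n} → Matrix (suc n) → Fin (suc n) → ℤ
laplaceTerm {n} M j = sign (toℕ j) * (M zero j * det n (minor M zero j))

laplaceTerm-entry≡0 : ∀ {n} (M : Matrix (suc n)) j → M zero j ≡ 0ℤ → laplaceTerm M j ≡ 0ℤ
laplaceTerm-entry≡0 {n} M j entry≡0 = trans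
  (cong (λ x → sign (toℕ j) * (x * det n (minor M zero j))) entry≡0)
  (trans (cong (sign (toℕ j) *_) (ℤP.*-zeroˡ (det n (minor M zero j)))) (ℤP.*-zeroʳ (sign (toℕ j))))

laplaceTerm-minor≡0 : ∀ {n} (M : Matrix (suc n)) j → det n (minor M zero j) ≡ 0ℤ → laplaceTerm M j ≡ 0ℤ
laplaceTerm-minor≡0 M j minor≡0 = trans
  (cong (λ d → sign (toℕ j) * (M zero j * d)) minor≡0)
  (trans (cong (sign (toℕ j) *_) (ℤP.*-zeroʳ (M zero j))) (ℤP.*-zeroʳ (sign (toℕ j))))

det-cong : ∀ n {M N : Matrix n} → (∀ i j → M i j ≡ N i j) → det n M ≡ det n N
det-cong zero    M≗N = refl
det-cong (suc n) M≗N = sumℤ-cong (suc n) λ j →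
  cong₂ (λ a d → sign (toℕ j) * (a * d)) (M≗N zero j) (det-cong n (λ a b → M≗N (suc a) (punchIn j b)))

sign-suc : ∀ k → sign (suc k) ≡ - sign k
sign-suc zero          = refl
sign-suc (suc zero)    = refl
sign-suc (suc (suc k)) = sign-suc k

det-additive-column : ∀ n (c : Fin n) (A B C : Matrix n) →
  (∀ i j → j ≢ c → A i j ≡ C i j) → (∀ i j → j ≢ c → B i j ≡ C i j) →
  (∀ i → C i c ≡ A i c + B i c) → det n C ≡ det n A + det n B
det-additive-column (suc n) c A B C A≈C B≈C C≡A+B =
  trans (sumℤ-cong (suc n) term) (sumℤ-distrib-+ (suc n) (laplaceTerm A) (laplaceTerm B))
  where
  term : ∀ j → laplaceTerm C j ≡ laplaceTerm A j + laplaceTerm B j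
  term j with j F.≟ c
  ... | yes refl = begin
    s * (C zero j * dC)                 ≡⟨ cong (λ x → s * (x * dC)) (C≡A+B zero) ⟩
    s * ((A zero j + B zero j) * dC)    ≡⟨ distrib s (A zero j) (B zero j) dC ⟩
    s * (A zero j * dC) + s * (B zero j * dC)
      ≡⟨ cong₂ (λ u v → s * (A zero j * u) + s * (B zero j * v)) (sameMinor A≈C) (sameMinor B≈C) ⟩
    laplaceTerm A j + laplaceTerm B j   ∎
    where
    open ≡-Reasoning
    s = sign (toℕ j)
    dC = det n (minor C zero j)
    sameMinor : ∀ {X} → (∀ i k → k ≢ c → X i k ≡ C i k) → dC ≡ det n (minor X zero j)
    sameMinor X≈C = det-cong n (λ a b → sym (X≈C (suc a) (punchIn j b) (punchInᵢ≢i j b)))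
    distrib : ∀ s a b d → s * ((a + b) * d) ≡ s * (a * d) + s * (b * d)
    distrib = solve-∀
  ... | no j≢c = begin
    s * (C zero j * det n (minor C zero j))
      ≡⟨ cong (λ d → s * (C zero j * d)) minors ⟩
    s * (C zero j * (det n (minor A zero j) + det n (minor B zero j)))
      ≡⟨ distrib s (C zero j) _ _ ⟩
    s * (C zero j * det n (minor A zero j)) + s * (C zero j * det n (minor B zero j))
      ≡⟨ cong₂ (λ x y → s * (x * det n (minor A zero j)) + s * (y * det n (minor B zero j)))
               (sym (A≈C zero j j≢c)) (sym (B≈C zero j j≢c)) ⟩
    laplaceTerm A j + laplaceTerm B j ∎
    where
    open ≡-Reasoning
    s = sign (toℕ j)
    c′ = punchOut j≢c
    off : ∀ b → b ≢ c′ → punchIn j b ≢ c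
    off b b≢c′ eq = b≢c′ (punchIn-injective j b c′ (trans eq (sym (punchIn-punchOut j≢c))))
    minors : det n (minor C zero j) ≡ det n (minor A zero j) + det n (minor B zero j)
    minors = det-additive-column n c′ (minor A zero j) (minor B zero j) (minor C zero j)
      (λ a b b≢c′ → A≈C (suc a) (punchIn j b) (off b b≢c′))
      (λ a b b≢c′ → B≈C (suc a) (punchIn j b) (off b b≢c′))
      (λ a → subst (λ k → C (suc a) k ≡ A (suc a) k + B (suc a) k) (sym (punchIn-punchOut j≢c)) (C≡A+B (suc a)))
    distrib : ∀ s x a b → s * (x * (a + b)) ≡ s * (x * a) + s * (x * b)
    distrib = solve-∀

det-zero-column : ∀ n (c : Fin n) (M : Matrix n) → (∀ i → M i c ≡ 0ℤ) → det n M ≡ 0ℤ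
det-zero-column n c M M·c≡0 = x≡x+x⇒x≡0 (det-additive-column n c M M M (λ _ _ _ → refl) (λ _ _ _ → refl)
  (λ i → trans (M·c≡0 i) (sym (cong₂ _+_ (M·c≡0 i) (M·c≡0 i)))))
  where
  x≡x+x⇒x≡0 : ∀ {x} → x ≡ x + x → x ≡ 0ℤ
  x≡x+x⇒x≡0 {x} eq = trans (sym (l x)) (trans (cong (_- x) (sym eq)) (ℤP.+-inverseʳ x))
    where l : ∀ x → (x + x) - x ≡ x
          l = solve-∀

data Adjacent : ∀ {n} → Fin (suc n) → Fin (suc n) → Set where
  adj-zero : ∀ {n} → Adjacent {suc n} zero (suc zero)
  adj-suc  : ∀ {n} {a b : Fin (suc n)} → Adjacent a b → Adjacent (suc a) (suc b)

adjacent-toℕ : ∀ {n} {a b : Fin (suc n)} → Adjacent a b → toℕ b ≡ suc (toℕ a)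
adjacent-toℕ adj-zero    = refl
adjacent-toℕ (adj-suc a) = cong suc (adjacent-toℕ a)

adjacent⇒≢ : ∀ {n} {a b : Fin (suc n)} → Adjacent a b → a ≢ b
adjacent⇒≢ adj-zero    ()
adjacent⇒≢ (adj-suc a) eq = adjacent⇒≢ a (suc-injective eq)

adjacent-inject₁ : ∀ {m} (c : Fin m) → Adjacent (inject₁ c) (suc c)
adjacent-inject₁ zero    = adj-zero
adjacent-inject₁ (suc c) = adj-suc (adjacent-inject₁ c)

punchIn-adjacent : ∀ {n} {a b : Fin (suc n)} → Adjacent a b → ∀ k →
  punchIn a k ≡ punchIn b k ⊎ (punchIn a k ≡ b × punchIn b k ≡ a)
punchIn-adjacent adj-zero    zero    = inj₂ (refl , refl)
punchIn-adjacent adj-zero    (suc k) = inj₁ refl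
punchIn-adjacent (adj-suc a) zero    = inj₁ refl
punchIn-adjacent (adj-suc a) (suc k) with punchIn-adjacent a k
... | inj₁ eq          = inj₁ (cong suc eq)
... | inj₂ (eq₁ , eq₂) = inj₂ (cong suc eq₁ , cong suc eq₂)

punchOut-adjacent : ∀ {n} {a b : Fin (suc (suc n))} → Adjacent a b → ∀ k (k≢a : k ≢ a) (k≢b : k ≢ b) →
  Adjacent (punchOut k≢a) (punchOut k≢b)
punchOut-adjacent adj-zero    zero                k≢a k≢b = ⊥-elim (k≢a refl)
punchOut-adjacent adj-zero    (suc zero)          k≢a k≢b = ⊥-elim (k≢b refl)
punchOut-adjacent adj-zero    (suc (suc zero))    k≢a k≢b = adj-zero
punchOut-adjacent adj-zero    (suc (suc (suc k))) k≢a k≢b = adj-zero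
punchOut-adjacent (adj-suc a) zero                k≢a k≢b = a
punchOut-adjacent (adj-suc a@adj-zero)      (suc k) k≢a k≢b =
  adj-suc (punchOut-adjacent a k (k≢a ∘ cong suc) (k≢b ∘ cong suc))
punchOut-adjacent (adj-suc a@(adj-suc _))  (suc k) k≢a k≢b =
  adj-suc (punchOut-adjacent a k (k≢a ∘ cong suc) (k≢b ∘ cong suc))

det-adjacent-equal-columns : ∀ n (M : Matrix (suc n)) {a b : Fin (suc n)} → Adjacent a b →
  (∀ i → M i a ≡ M i b) → det (suc n) M ≡ 0ℤ
det-adjacent-equal-columns zero    M ()
det-adjacent-equal-columns (suc n) M {a} {b} adj Ma≡Mb =
  trans (sumℤ-pair (suc (suc n)) (laplaceTerm M) a b (adjacent⇒≢ adj) others) pairCancels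
  where
  others : ∀ j → j ≢ a → j ≢ b → laplaceTerm M j ≡ 0ℤ
  others j j≢a j≢b = laplaceTerm-minor≡0 M j
    (det-adjacent-equal-columns n (minor M zero j) (punchOut-adjacent adj j j≢a j≢b) λ i →
      trans (cong (M (suc i)) (punchIn-punchOut j≢a))
            (trans (Ma≡Mb (suc i)) (sym (cong (M (suc i)) (punchIn-punchOut j≢b)))))
  sameMinor : ∀ i k → minor M zero a i k ≡ minor M zero b i k
  sameMinor i k with punchIn-adjacent adj k
  ... | inj₁ eq          = cong (M (suc i)) eq
  ... | inj₂ (eq₁ , eq₂) = trans (cong (M (suc i)) eq₁) (trans (sym (Ma≡Mb (suc i))) (sym (cong (M (suc i)) eq₂)))
  pairCancels : laplaceTerm M a + laplaceTerm M b ≡ 0ℤ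
  pairCancels = begin
    s * (M zero a * d) + sign (toℕ b) * (M zero b * det (suc n) (minor M zero b))
      ≡⟨ cong₂ (λ t u → s * (M zero a * d) + t * u)
               (trans (cong sign (adjacent-toℕ adj)) (sign-suc (toℕ a)))
               (cong₂ _*_ (sym (Ma≡Mb zero)) (sym (det-cong (suc n) sameMinor))) ⟩
    s * (M zero a * d) + (- s) * (M zero a * d)
      ≡⟨ cancel s (M zero a * d) ⟩
    0ℤ ∎
    where
    open ≡-Reasoning
    s = sign (toℕ a)
    d = det (suc n) (minor M zero a)
    cancel : ∀ s t → s * t + (- s) * t ≡ 0ℤ
    cancel = solve-∀

setColumn : ∀ {n} → Matrix n → Fin n → Vecℤ n → Matrix n
setColumn M c u i j with j F.≟ c
... | yes _ = u i
... | no  _ = M i j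

setColumn-at : ∀ {n} (M : Matrix n) c u i → setColumn M c u i c ≡ u i
setColumn-at M c u i with c F.≟ c
... | yes _   = refl
... | no  c≢c = ⊥-elim (c≢c refl)

setColumn-off : ∀ {n} (M : Matrix n) c u i j → j ≢ c → setColumn M c u i j ≡ M i j
setColumn-off M c u i j j≢c with j F.≟ c
... | yes j≡c = ⊥-elim (j≢c j≡c)
... | no  _   = refl

det-subtract-adjacent-column : ∀ n (M M′ : Matrix (suc n)) {a b : Fin (suc n)} → Adjacent a b →
  (∀ i j → j ≢ b → M′ i j ≡ M i j) → (∀ i → M′ i b ≡ M i b - M i a) → det (suc n) M′ ≡ det (suc n) M
det-subtract-adjacent-column n M M′ {a} {b} adj M′≈M M′b = begin
  det (suc n) M′             ≡⟨ det-additive-column (suc n) b M N M′ (λ i j j≢b → sym (M′≈M i j j≢b)) (offN M′≈M)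
                                  (λ i → trans (M′b i) (cong (λ t → M i b + t) (sym (setColumn-at M b _ i)))) ⟩
  det (suc n) M + det (suc n) N ≡⟨ cong (λ t → det (suc n) M + t) detN≡0 ⟩
  det (suc n) M + 0ℤ         ≡⟨ ℤP.+-identityʳ _ ⟩
  det (suc n) M              ∎
  where
  open ≡-Reasoning
  copy = setColumn M b (λ i → M i a)
  N    = setColumn M b (λ i → - M i a)
  zeroed = setColumn M b (λ _ → 0ℤ)
  offN : ∀ {X : Matrix (suc n)} → (∀ i j → j ≢ b → X i j ≡ M i j) → ∀ i j → j ≢ b → N i j ≡ X i j
  offN X≈M i j j≢b = trans (setColumn-off M b _ i j j≢b) (sym (X≈M i j j≢b))
  detN≡0 : det (suc n) N ≡ 0ℤ
  detN≡0 = begin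
    det (suc n) N                           ≡⟨ sym (ℤP.+-identityˡ _) ⟩
    0ℤ + det (suc n) N                      ≡⟨ cong (_+ det (suc n) N) (sym (det-adjacent-equal-columns n copy adj
                                                 λ i → trans (setColumn-off M b _ i a (adjacent⇒≢ adj)) (sym (setColumn-at M b _ i)))) ⟩
    det (suc n) copy + det (suc n) N        ≡⟨ sym (det-additive-column (suc n) b copy N zeroed
                                                 (λ i j j≢b → trans (setColumn-off M b _ i j j≢b) (sym (setColumn-off M b _ i j j≢b)))
                                                 (λ i j j≢b → trans (setColumn-off M b _ i j j≢b) (sym (setColumn-off M b _ i j j≢b)))
                                                 λ i → trans (setColumn-at M b _ i)
                                                   (trans (sym (ℤP.+-inverseʳ (M i a))) (sym (cong₂ _+_ (setColumn-at M b _ i) (setColumn-at M b _ i))))) ⟩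
    det (suc n) zeroed                      ≡⟨ det-zero-column (suc n) b zeroed (setColumn-at M b _) ⟩
    0ℤ                                      ∎

-- Lowering k by one is a single adjacent-column subtraction.
columnDifferencesFrom : ∀ {m} → ℕ → Matrix (suc m) → Matrix (suc m)
columnDifferencesFrom k M i zero    = M i zero
columnDifferencesFrom k M i (suc j) =
  if does (k ℕ.≤? toℕ j) then M i (suc j) - M i (inject₁ j) else M i (suc j)

columnDifferencesFrom-below : ∀ {m} k (M : Matrix (suc m)) i j → toℕ j ℕ.< k →
  columnDifferencesFrom k M i (suc j) ≡ M i (suc j)
columnDifferencesFrom-below k M i j j<k
  rewrite dec-false (k ℕ.≤? toℕ j) (ℕP.<⇒≱ j<k) = refl

columnDifferencesFrom-inject₁ : ∀ {m} k (M : Matrix (suc m)) i (c : Fin m) → toℕ c ℕ.≤ k →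
  columnDifferencesFrom (suc k) M i (inject₁ c) ≡ M i (inject₁ c)
columnDifferencesFrom-inject₁ k M i zero    c≤k = refl
columnDifferencesFrom-inject₁ k M i (suc c) c<k =
  columnDifferencesFrom-below (suc k) M i (inject₁ c)
    (subst (ℕ._< suc k) (sym (toℕ-inject₁ c)) (s≤s (ℕP.<⇒≤ c<k)))

det-columnDifferencesFrom : ∀ m (M : Matrix (suc m)) d k → k ℕ.+ d ≡ m →
  det (suc m) (columnDifferencesFrom k M) ≡ det (suc m) M
det-columnDifferencesFrom m M zero k refl = det-cong (suc m) unchanged
  where
  unchanged : ∀ i j → columnDifferencesFrom k M i j ≡ M i j
  unchanged i zero    = refl
  unchanged i (suc j) = columnDifferencesFrom-below k M i j
    (subst (toℕ j ℕ.<_) (ℕP.+-identityʳ k) (toℕ<n j))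
det-columnDifferencesFrom m M (suc d) k k+d≡m = begin
  det (suc m) (columnDifferencesFrom k M)
    ≡⟨ det-subtract-adjacent-column m (columnDifferencesFrom (suc k) M) (columnDifferencesFrom k M)
         (adjacent-inject₁ c) sameOff subtracted ⟩
  det (suc m) (columnDifferencesFrom (suc k) M)
    ≡⟨ det-columnDifferencesFrom m M d (suc k) (trans (sym (ℕP.+-suc k d)) k+d≡m) ⟩
  det (suc m) M ∎
  where
  open ≡-Reasoning
  k<m : k ℕ.< m
  k<m = subst (k ℕ.<_) k+d≡m (ℕP.m<m+n k (s≤s z≤n))
  c : Fin m
  c = F.fromℕ< k<m
  toℕc≡k : toℕ c ≡ k
  toℕc≡k = toℕ-fromℕ< k<m
  step : ∀ t → t ≢ k → does (k ℕ.≤? t) ≡ does (suc k ℕ.≤? t)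
  step t t≢k with ℕP.≤-total k t
  ... | inj₁ k≤t = trans (dec-true (k ℕ.≤? t) k≤t) (sym (dec-true (suc k ℕ.≤? t) (ℕP.≤∧≢⇒< k≤t (t≢k ∘ sym))))
  ... | inj₂ t≤k = trans (dec-false (k ℕ.≤? t) (ℕP.<⇒≱ t<k)) (sym (dec-false (suc k ℕ.≤? t) (ℕP.<⇒≱ (ℕP.m<n⇒m<1+n t<k))))
    where t<k = ℕP.≤∧≢⇒< t≤k t≢k
  sameOff : ∀ i j → j ≢ suc c → columnDifferencesFrom k M i j ≡ columnDifferencesFrom (suc k) M i j
  sameOff i zero    _      = refl
  sameOff i (suc j) j≢c    =
    cong (λ b → if b then M i (suc j) - M i (inject₁ j) else M i (suc j))
         (step (toℕ j) (λ j≡k → j≢c (cong suc (toℕ-injective (trans j≡k (sym toℕc≡k))))))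
  subtracted : ∀ i → columnDifferencesFrom k M i (suc c)
    ≡ columnDifferencesFrom (suc k) M i (suc c) - columnDifferencesFrom (suc k) M i (inject₁ c)
  subtracted i
    rewrite columnDifferencesFrom-inject₁ k M i c (ℕP.≤-reflexive toℕc≡k)
          | columnDifferencesFrom-below (suc k) M i c (subst (ℕ._< suc k) (sym toℕc≡k) (ℕP.n<1+n k))
          | toℕc≡k
          | dec-true (k ℕ.≤? k) ℕP.≤-refl = refl

columnDifferences : ∀ {m} → Matrix (suc m) → Matrix (suc m)
columnDifferences = columnDifferencesFrom 0

det-columnDifferences : ∀ m (M : Matrix (suc m)) → det (suc m) (columnDifferences M) ≡ det (suc m) M
det-columnDifferences m M = det-columnDifferencesFrom m M m 0 refl

det-upperTriangular : ∀ n (M : Matrix n) → (∀ i j → toℕ j ℕ.< toℕ i → M i j ≡ 0ℤ) →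
  det n M ≡ prodℤ n (λ i → M i i)
det-upperTriangular zero    M _     = refl
det-upperTriangular (suc n) M lower≡0 = begin
  laplaceTerm M zero + sumℤ n (λ j → laplaceTerm M (suc j))
    ≡⟨ cong (λ t → laplaceTerm M zero + t) (sumℤ-zero n _ offDiagonal) ⟩
  laplaceTerm M zero + 0ℤ
    ≡⟨ ℤP.+-identityʳ _ ⟩
  1ℤ * (M zero zero * det n (minor M zero zero))
    ≡⟨ ℤP.*-identityˡ _ ⟩
  M zero zero * det n (minor M zero zero)
    ≡⟨ cong (M zero zero *_) (det-upperTriangular n (minor M zero zero) (λ i j j<i → lower≡0 (suc i) (suc j) (s≤s j<i))) ⟩
  prodℤ (suc n) (λ i → M i i) ∎
  where
  open ≡-Reasoning
  minorVanishes : ∀ j → det n (minor M zero (suc j)) ≡ 0ℤ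
  minorVanishes j@zero    = det-zero-column n zero (minor M zero (suc j)) (λ i → lower≡0 (suc i) zero (s≤s z≤n))
  minorVanishes j@(suc _) = det-zero-column n zero (minor M zero (suc j)) (λ i → lower≡0 (suc i) zero (s≤s z≤n))
  offDiagonal : ∀ j → laplaceTerm M (suc j) ≡ 0ℤ
  offDiagonal j = laplaceTerm-minor≡0 M (suc j) (minorVanishes j)

dropFactor : ∀ {n} → Vecℤ n → Fin n → Vecℤ n
dropFactor y i j = if does (j F.≟ i) then 1ℤ else y j

prodExcept : ∀ {n} → Vecℤ n → Fin n → ℤ
prodExcept {n} y i = prodℤ n (dropFactor y i)

prodℤ-extract : ∀ n (f : Vecℤ n) c → prodℤ n f ≡ f c * prodExcept f c
prodℤ-extract (suc n) f zero    = cong (f zero *_) (sym (ℤP.*-identityˡ _))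
prodℤ-extract (suc n) f (suc c) = begin
  f zero * prodℤ n (f ∘ suc)                          ≡⟨ cong (f zero *_) (prodℤ-extract n (f ∘ suc) c) ⟩
  f zero * (f (suc c) * prodExcept (f ∘ suc) c)       ≡⟨ swap (f zero) (f (suc c)) _ ⟩
  f (suc c) * (f zero * prodExcept (f ∘ suc) c)       ∎
  where
  open ≡-Reasoning
  swap : ∀ a b p → a * (b * p) ≡ b * (a * p)
  swap = solve-∀

prodExcept-* : ∀ {n} (y : Vecℤ n) i → y i * prodExcept y i ≡ prodℤ n y
prodExcept-* {n} y i = sym (prodℤ-extract n y i)

prodExcept₂ : ∀ {n} → Vecℤ n → Fin n → Fin n → ℤ
prodExcept₂ y i k = prodExcept (dropFactor y k) i

prodExcept₂-diagonal : ∀ {n} (y : Vecℤ n) i → prodExcept₂ y i i ≡ prodExcept y i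
prodExcept₂-diagonal {n} y i = prodℤ-cong n dropTwice
  where
  dropTwice : ∀ j → dropFactor (dropFactor y i) i j ≡ dropFactor y i j
  dropTwice j with j F.≟ i
  ... | yes _ = refl
  ... | no  _ = refl

*-prodExcept₂ : ∀ {n} (y : Vecℤ n) {i k} → k ≢ i → y i * prodExcept₂ y i k ≡ prodExcept y k
*-prodExcept₂ {n} y {i} {k} k≢i = begin
  y i * prodExcept₂ y i k                   ≡⟨ cong (_* prodExcept₂ y i k) (sym yᵢ-kept) ⟩
  dropFactor y k i * prodExcept₂ y i k      ≡⟨ sym (prodℤ-extract n (dropFactor y k) i) ⟩
  prodExcept y k                            ∎
  where
  open ≡-Reasoning
  yᵢ-kept : dropFactor y k i ≡ y i
  yᵢ-kept = cong (λ b → if b then 1ℤ else y i) (dec-false (i F.≟ k) (k≢i ∘ sym))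

prodExcept-pos : ∀ {n} (y : Vecℤ n) → (∀ i → 0ℤ <ℤ y i) → ∀ i → 0ℤ <ℤ prodExcept y i
prodExcept-pos {n} y y>0 i = prodℤ-pos n (dropFactor y i) factor>0
  where
  factor>0 : ∀ j → 0ℤ <ℤ dropFactor y i j
  factor>0 j with j F.≟ i
  ... | yes _ = +<+ (s≤s z≤n)
  ... | no  _ = y>0 j

-- M_{K_n}(a) = Diag(a) − (J − I) = Diag(a + 1) − J.
Diag−J : ∀ {n} → Vecℤ n → Matrix n
Diag−J {n} y = MG (completeAdj n) (λ i → y i - 1ℤ)

Diag−J-diagonal : ∀ {n} (y : Vecℤ n) i → Diag−J y i i ≡ y i - 1ℤ
Diag−J-diagonal y i with i F.≟ i
... | yes _   = ℤP.+-identityʳ (y i - 1ℤ)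
... | no  i≢i = ⊥-elim (i≢i refl)

Diag−J-offDiagonal : ∀ {n} (y : Vecℤ n) {i j} → i ≢ j → Diag−J y i j ≡ -1ℤ
Diag−J-offDiagonal y {i} {j} i≢j with i F.≟ j
... | yes i≡j = ⊥-elim (i≢j i≡j)
... | no  _   = refl

MG-cong : ∀ {n} (A : Matrix n) {a b : Vecℤ n} → (∀ i → a i ≡ b i) → ∀ i j → MG A a i j ≡ MG A b i j
MG-cong A a≗b i j with i F.≟ j
... | yes refl = cong (_- A i i) (a≗b i)
... | no  _    = refl

withFirstRowOnes : ∀ {n} → Matrix (suc n) → Matrix (suc n)
withFirstRowOnes M zero    j = 1ℤ
withFirstRowOnes M (suc i) j = M (suc i) j

-- Taking column differences turns the first row into (1, 0, …, 0) and leaves an upper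
-- bidiagonal minor with diagonal y₁, …, yₙ.
det-withFirstRowOnes-Diag−J : ∀ n (y : Vecℤ (suc n)) →
  det (suc n) (withFirstRowOnes (Diag−J y)) ≡ prodℤ n (y ∘ suc)
det-withFirstRowOnes-Diag−J n y = begin
  det (suc n) B                         ≡⟨ sym (det-columnDifferences n B) ⟩
  det (suc n) (columnDifferences B)     ≡⟨ cong (λ t → laplaceTerm (columnDifferences B) zero + t) restVanishes ⟩
  1ℤ * (1ℤ * det n bidiagonal) + 0ℤ     ≡⟨ unit (det n bidiagonal) ⟩
  det n bidiagonal                      ≡⟨ det-upperTriangular n bidiagonal belowDiagonal ⟩
  prodℤ n (λ i → bidiagonal i i)        ≡⟨ prodℤ-cong n diagonal ⟩
  prodℤ n (y ∘ suc)                     ∎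
  where
  open ≡-Reasoning
  B = withFirstRowOnes (Diag−J y)
  bidiagonal = minor (columnDifferences B) zero zero
  unit : ∀ d → 1ℤ * (1ℤ * d) + 0ℤ ≡ d
  unit = solve-∀
  restVanishes : sumℤ n (λ j → laplaceTerm (columnDifferences B) (suc j)) ≡ 0ℤ
  restVanishes = sumℤ-zero n _ λ j → laplaceTerm-entry≡0 (columnDifferences B) (suc j) refl
  suc≢inject₁ : ∀ {i j} → toℕ j ℕ.≤ toℕ i → suc i ≢ inject₁ j
  suc≢inject₁ {i} {j} j≤i eq =
    ℕP.1+n≰n (subst (ℕ._≤ toℕ i) (sym (trans (cong toℕ eq) (toℕ-inject₁ j))) j≤i)
  belowDiagonal : ∀ i j → toℕ j ℕ.< toℕ i → bidiagonal i j ≡ 0ℤ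
  belowDiagonal i j j<i =
    cong₂ _-_ (Diag−J-offDiagonal y (λ i≡j → ℕP.<-irrefl (cong toℕ (sym (suc-injective i≡j))) j<i))
              (Diag−J-offDiagonal y (suc≢inject₁ (ℕP.<⇒≤ j<i)))
  diagonal : ∀ i → bidiagonal i i ≡ y (suc i)
  diagonal i = trans (cong₂ _-_ (Diag−J-diagonal y (suc i)) (Diag−J-offDiagonal y (suc≢inject₁ {i} {i} ℕP.≤-refl))) (l (y (suc i)))
    where l : ∀ a → a - 1ℤ - -1ℤ ≡ a
          l = solve-∀

-- The Laplace expansion is linear in the first row, which is y₀ e₀ − (1, …, 1).
det-Diag−J-suc : ∀ n (y : Vecℤ (suc n)) →
  det (suc n) (Diag−J y) ≡ y zero * det n (Diag−J (y ∘ suc)) - prodℤ n (y ∘ suc)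
det-Diag−J-suc n y = begin
  laplaceTerm K zero + sumℤ n (λ j → laplaceTerm K (suc j))
    ≡⟨ cong₂ _+_ firstTerm (trans (sumℤ-cong n negated) (sym (neg-distrib-sumℤ n _))) ⟩
  (y zero - 1ℤ) * D₀ + - R
    ≡⟨ regroup (y zero) D₀ R ⟩
  y zero * D₀ - det (suc n) B
    ≡⟨ cong₂ (λ d b → y zero * d - b) (det-cong n minor₀₀) (det-withFirstRowOnes-Diag−J n y) ⟩
  y zero * det n (Diag−J (y ∘ suc)) - prodℤ n (y ∘ suc) ∎
  where
  open ≡-Reasoning
  K = Diag−J y
  B = withFirstRowOnes K
  D₀ = det n (minor K zero zero)
  R = sumℤ n (λ j → laplaceTerm B (suc j))
  firstTerm : laplaceTerm K zero ≡ (y zero - 1ℤ) * D₀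
  firstTerm = trans (ℤP.*-identityˡ _) (cong (_* D₀) (Diag−J-diagonal y zero))
  negated : ∀ j → laplaceTerm K (suc j) ≡ - laplaceTerm B (suc j)
  negated j = l (sign (toℕ (suc j))) (det n (minor B zero (suc j)))
    where l : ∀ s d → s * (-1ℤ * d) ≡ - (s * (1ℤ * d))
          l = solve-∀
  regroup : ∀ a d r → (a - 1ℤ) * d + - r ≡ a * d - (1ℤ * (1ℤ * d) + r)
  regroup = solve-∀
  minor₀₀ : ∀ i j → minor K zero zero i j ≡ Diag−J (y ∘ suc) i j
  minor₀₀ i j with i F.≟ j
  ... | yes refl = refl
  ... | no  _    = refl

det-Diag−J : ∀ n (y : Vecℤ n) → det n (Diag−J y) ≡ prodℤ n y - sumℤ n (prodExcept y)
det-Diag−J zero    y = refl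
det-Diag−J (suc n) y = begin
  det (suc n) (Diag−J y)           ≡⟨ det-Diag−J-suc n y ⟩
  y zero * det n (Diag−J y′) - P′  ≡⟨ cong (λ d → y zero * d - P′) (det-Diag−J n y′) ⟩
  y zero * (P′ - S′) - P′          ≡⟨ regroup (y zero) P′ S′ ⟩
  y zero * P′ - (1ℤ * P′ + y zero * S′) ≡⟨ cong (λ s → y zero * P′ - (1ℤ * P′ + s)) (*-distribˡ-sumℤ n (y zero) (prodExcept y′)) ⟩
  prodℤ (suc n) y - sumℤ (suc n) (prodExcept y) ∎
  where
  open ≡-Reasoning
  y′ = y ∘ suc
  P′ = prodℤ n y′
  S′ = sumℤ n (prodExcept y′)
  regroup : ∀ a p s → a * (p - s) - p ≡ a * p - (1ℤ * p + a * s)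
  regroup = solve-∀

unit-equation⇔det-Diag−J≡1 : ∀ n (y : Vecℤ n) →
  (sumℤ n (prodExcept y) + 1ℤ ≡ prodℤ n y) ⇔ (det n (Diag−J y) ≡ 1ℤ)
unit-equation⇔det-Diag−J≡1 n y = mk⇔
  (λ S+1≡P → trans (det-Diag−J n y) (trans (cong (_- S) (sym S+1≡P)) (cancel₁ S)))
  (λ det≡1 → trans (cong (λ t → S + t) (trans (sym det≡1) (det-Diag−J n y))) (cancel₂ S (prodℤ n y)))
  where
  S = sumℤ n (prodExcept y)
  cancel₁ : ∀ s → s + 1ℤ - s ≡ 1ℤ
  cancel₁ = solve-∀
  cancel₂ : ∀ s p → s + (p - s) ≡ p
  cancel₂ = solve-∀

fromℤ : ℤ → ℚ
fromℤ z = z ℚ./ 1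

toℚᵘ-fromℤ : ∀ z → toℚᵘ (fromℤ z) ℚᵘ.≃ mkℚᵘ z 0
toℚᵘ-fromℤ z = ℚP.toℚᵘ-fromℚᵘ (mkℚᵘ z 0)

fromℤ-+ : ∀ a b → fromℤ (a + b) ≡ fromℤ a ℚ.+ fromℤ b
fromℤ-+ a b = ℚP.toℚᵘ-injective (begin
  toℚᵘ (fromℤ (a + b))                 ≈⟨ toℚᵘ-fromℤ (a + b) ⟩
  mkℚᵘ (a + b) 0                       ≈⟨ *≡* (l a b) ⟩
  mkℚᵘ a 0 ℚᵘ.+ mkℚᵘ b 0               ≈⟨ ℚᵘP.+-cong (toℚᵘ-fromℤ a) (toℚᵘ-fromℤ b) ⟨
  toℚᵘ (fromℤ a) ℚᵘ.+ toℚᵘ (fromℤ b)   ≈⟨ ℚP.toℚᵘ-homo-+ (fromℤ a) (fromℤ b) ⟨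
  toℚᵘ (fromℤ a ℚ.+ fromℤ b)           ∎)
  where
  open ℚᵘP.≃-Reasoning
  l : ∀ a b → (a + b) * 1ℤ ≡ (a * 1ℤ + b * 1ℤ) * 1ℤ
  l = solve-∀

fromℤ-* : ∀ a b → fromℤ (a * b) ≡ fromℤ a ℚ.* fromℤ b
fromℤ-* a b = ℚP.toℚᵘ-injective (begin
  toℚᵘ (fromℤ (a * b))                 ≈⟨ toℚᵘ-fromℤ (a * b) ⟩
  mkℚᵘ (a * b) 0                       ≈⟨ ℚᵘP.*-cong (toℚᵘ-fromℤ a) (toℚᵘ-fromℤ b) ⟨
  toℚᵘ (fromℤ a) ℚᵘ.* toℚᵘ (fromℤ b)   ≈⟨ ℚP.toℚᵘ-homo-* (fromℤ a) (fromℤ b) ⟨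
  toℚᵘ (fromℤ a ℚ.* fromℤ b)           ∎)
  where open ℚᵘP.≃-Reasoning

fromℤ-injective : ∀ {a b} → fromℤ a ≡ fromℤ b → a ≡ b
fromℤ-injective {a} {b} eq
  with ℚᵘP.≃-trans (ℚᵘP.≃-sym (toℚᵘ-fromℤ a)) (ℚᵘP.≃-trans (ℚᵘP.≃-reflexive (cong toℚᵘ eq)) (toℚᵘ-fromℤ b))
... | *≡* a*1≡b*1 = trans (sym (ℤP.*-identityʳ a)) (trans a*1≡b*1 (ℤP.*-identityʳ b))

recip-inverse : ∀ {z} → 0ℤ <ℤ z → recip z ℚ.* fromℤ z ≡ 1ℚ
recip-inverse {ℤ.+[1+ k ]} _ = ℚP.toℚᵘ-injective (begin
  toℚᵘ (recip ℤ.+[1+ k ] ℚ.* fromℤ ℤ.+[1+ k ])                 ≈⟨ ℚP.toℚᵘ-homo-* (recip ℤ.+[1+ k ]) (fromℤ ℤ.+[1+ k ]) ⟩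
  toℚᵘ (recip ℤ.+[1+ k ]) ℚᵘ.* toℚᵘ (fromℤ ℤ.+[1+ k ])         ≈⟨ ℚᵘP.*-cong (ℚP.toℚᵘ-fromℚᵘ (mkℚᵘ 1ℤ k)) (toℚᵘ-fromℤ ℤ.+[1+ k ]) ⟩
  mkℚᵘ 1ℤ k ℚᵘ.* mkℚᵘ ℤ.+[1+ k ] 0                             ≈⟨ *≡* (ℤP.*-assoc 1ℤ ℤ.+[1+ k ] 1ℤ) ⟩
  ℚᵘ.1ℚᵘ                                                       ∎)
  where open ℚᵘP.≃-Reasoning
recip-inverse {ℤ.+ zero} (+<+ ())

fromℤ-prod*sumRecip : ∀ n (y : Vecℤ n) → (∀ i → 0ℤ <ℤ y i) →
  fromℤ (prodℤ n y) ℚ.* sumℚ n (λ i → recip (y i)) ≡ fromℤ (sumℤ n (prodExcept y))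
fromℤ-prod*sumRecip zero    y y>0 = refl
fromℤ-prod*sumRecip (suc n) y y>0 = begin
  fromℤ (y zero * P′) ℚ.* (r ℚ.+ s)                           ≡⟨ cong (ℚ._* (r ℚ.+ s)) (fromℤ-* (y zero) P′) ⟩
  Y ℚ.* fromℤ P′ ℚ.* (r ℚ.+ s)                                 ≡⟨ expand Y (fromℤ P′) r s ⟩
  fromℤ P′ ℚ.* (r ℚ.* Y) ℚ.+ Y ℚ.* (fromℤ P′ ℚ.* s)            ≡⟨ cong₂ (λ u v → fromℤ P′ ℚ.* u ℚ.+ Y ℚ.* v)
                                                                         (recip-inverse (y>0 zero)) (fromℤ-prod*sumRecip n (y ∘ suc) (y>0 ∘ suc)) ⟩
  fromℤ P′ ℚ.* 1ℚ ℚ.+ Y ℚ.* fromℤ S′                          ≡⟨ cong₂ ℚ._+_ (trans (ℚP.*-identityʳ _) (cong fromℤ (sym (ℤP.*-identityˡ P′))))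
                                                                          (sym (fromℤ-* (y zero) S′)) ⟩
  fromℤ (1ℤ * P′) ℚ.+ fromℤ (y zero * S′)                      ≡⟨ sym (fromℤ-+ (1ℤ * P′) (y zero * S′)) ⟩
  fromℤ (1ℤ * P′ + y zero * S′)                                ≡⟨ cong (λ t → fromℤ (1ℤ * P′ + t)) (*-distribˡ-sumℤ n (y zero) (prodExcept (y ∘ suc))) ⟩
  fromℤ (sumℤ (suc n) (prodExcept y))                          ∎
  where
  open ≡-Reasoning
  P′ = prodℤ n (y ∘ suc)
  S′ = sumℤ n (prodExcept (y ∘ suc))
  Y = fromℤ (y zero)
  r = recip (y zero)
  s = sumℚ n (λ i → recip (y (suc i)))
  expand : ∀ a p r s → a ℚ.* p ℚ.* (r ℚ.+ s) ≡ p ℚ.* (r ℚ.* a) ℚ.+ a ℚ.* (p ℚ.* s)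
  expand = solve 4 (λ a p r s → a :* p :* (r :+ s) := p :* (r :* a) :+ a :* (p :* s)) refl

egyptian⇔unit-equation : ∀ n (y : Vecℤ n) → (∀ i → 0ℤ <ℤ y i) →
  (sumℚ n (λ i → recip (y i)) ℚ.+ recip (prodℤ n y) ≡ 1ℚ) ⇔ (sumℤ n (prodExcept y) + 1ℤ ≡ prodℤ n y)
egyptian⇔unit-equation n y y>0 = mk⇔ to from
  where
  open ≡-Reasoning
  P = prodℤ n y
  S = sumℤ n (prodExcept y)
  s = sumℚ n (λ i → recip (y i))
  r = recip P
  r*P≡1 : r ℚ.* fromℤ P ≡ 1ℚ
  r*P≡1 = recip-inverse (prodℤ-pos n y y>0)
  to : s ℚ.+ r ≡ 1ℚ → S + 1ℤ ≡ P
  to eq = fromℤ-injective (begin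
    fromℤ (S + 1ℤ)                    ≡⟨ fromℤ-+ S 1ℤ ⟩
    fromℤ S ℚ.+ 1ℚ                    ≡⟨ cong₂ ℚ._+_ (sym (fromℤ-prod*sumRecip n y y>0)) (sym (trans (ℚP.*-comm (fromℤ P) r) r*P≡1)) ⟩
    fromℤ P ℚ.* s ℚ.+ fromℤ P ℚ.* r   ≡⟨ sym (ℚP.*-distribˡ-+ (fromℤ P) s r) ⟩
    fromℤ P ℚ.* (s ℚ.+ r)             ≡⟨ cong (fromℤ P ℚ.*_) eq ⟩
    fromℤ P ℚ.* 1ℚ                    ≡⟨ ℚP.*-identityʳ (fromℤ P) ⟩
    fromℤ P                           ∎)
  from : S + 1ℤ ≡ P → s ℚ.+ r ≡ 1ℚ
  from S+1≡P = begin
    s ℚ.+ r                                ≡⟨ cong₂ ℚ._+_ (sym (trans (cong (ℚ._* s) r*P≡1) (ℚP.*-identityˡ s))) (sym (ℚP.*-identityʳ r)) ⟩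
    r ℚ.* fromℤ P ℚ.* s ℚ.+ r ℚ.* 1ℚ       ≡⟨ cong (ℚ._+ r ℚ.* 1ℚ) (ℚP.*-assoc r (fromℤ P) s) ⟩
    r ℚ.* (fromℤ P ℚ.* s) ℚ.+ r ℚ.* 1ℚ     ≡⟨ sym (ℚP.*-distribˡ-+ r (fromℤ P ℚ.* s) 1ℚ) ⟩
    r ℚ.* (fromℤ P ℚ.* s ℚ.+ 1ℚ)           ≡⟨ cong (λ t → r ℚ.* (t ℚ.+ 1ℚ)) (fromℤ-prod*sumRecip n y y>0) ⟩
    r ℚ.* (fromℤ S ℚ.+ 1ℚ)                 ≡⟨ cong (r ℚ.*_) (trans (sym (fromℤ-+ S 1ℤ)) (cong fromℤ S+1≡P)) ⟩
    r ℚ.* fromℤ P                          ≡⟨ r*P≡1 ⟩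
    1ℚ                                     ∎

egyptian⇔det-Diag−J≡1 : ∀ n (y : Vecℤ n) → (∀ i → 0ℤ <ℤ y i) →
  (sumℚ n (λ i → recip (y i)) ℚ.+ recip (prodℤ n y) ≡ 1ℚ) ⇔ (det n (Diag−J y) ≡ 1ℤ)
egyptian⇔det-Diag−J≡1 n y y>0 = ⇔.trans (egyptian⇔unit-equation n y y>0) (unit-equation⇔det-Diag−J≡1 n y)

quad≡sum-*· : ∀ n (M : Matrix n) X → quad M X ≡ sumℤ n (λ i → X i * (M · X) i)
quad≡sum-*· n M X = sumℤ-cong n λ i → sym (*-distribˡ-sumℤ n (X i) (λ j → M i j * X j))

Diag−J-· : ∀ n (y Y : Vecℤ n) i → (Diag−J y · Y) i ≡ y i * Y i - sumℤ n Y
Diag−J-· n y Y i = begin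
  sumℤ n (λ j → Diag−J y i j * Y j)                    ≡⟨ sumℤ-cong n split ⟩
  sumℤ n (λ j → diagonalPart j + - Y j)                ≡⟨ sumℤ-distrib-+ n diagonalPart (λ j → - Y j) ⟩
  sumℤ n diagonalPart + sumℤ n (λ j → - Y j)           ≡⟨ cong₂ _+_ (sumℤ-single n diagonalPart i offDiagonal) (sym (neg-distrib-sumℤ n Y)) ⟩
  diagonalPart i - sumℤ n Y                            ≡⟨ cong (λ b → (if b then y i * Y i else 0ℤ) - sumℤ n Y) (dec-true (i F.≟ i) refl) ⟩
  y i * Y i - sumℤ n Y                                 ∎
  where
  open ≡-Reasoning
  diagonalPart : Vecℤ n
  diagonalPart j = if does (i F.≟ j) then y i * Y j else 0ℤ
  split : ∀ j → Diag−J y i j * Y j ≡ diagonalPart j + - Y j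
  split j with i F.≟ j
  ... | yes refl = l (y i) (Y i)
    where l : ∀ a b → ((a - 1ℤ) - 0ℤ) * b ≡ a * b + - b
          l = solve-∀
  ... | no  _    = trans (ℤP.-1*i≡-i (Y j)) (sym (ℤP.+-identityˡ (- Y j)))
  offDiagonal : ∀ j → j ≢ i → diagonalPart j ≡ 0ℤ
  offDiagonal j j≢i = cong (λ b → if b then y i * Y j else 0ℤ) (dec-false (i F.≟ j) (j≢i ∘ sym))

quad-Diag−J : ∀ n (y X : Vecℤ n) →
  quad (Diag−J y) X ≡ sumℤ n (λ i → X i * (y i * X i)) - sumℤ n X * sumℤ n X
quad-Diag−J n y X = begin
  quad (Diag−J y) X                                             ≡⟨ quad≡sum-*· n (Diag−J y) X ⟩
  sumℤ n (λ i → X i * (Diag−J y · X) i)                        ≡⟨ sumℤ-cong n (λ i → cong (X i *_) (Diag−J-· n y X i)) ⟩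
  sumℤ n (λ i → X i * (y i * X i - s))                          ≡⟨ sumℤ-cong n (λ i → l (X i) (y i) s) ⟩
  sumℤ n (λ i → X i * (y i * X i) + - (s * X i))                ≡⟨ sumℤ-distrib-+ n _ _ ⟩
  Q + sumℤ n (λ i → - (s * X i))                                ≡⟨ cong (λ t → Q + t) (sym (neg-distrib-sumℤ n _)) ⟩
  Q - sumℤ n (λ i → s * X i)                                    ≡⟨ cong (λ t → Q - t) (sym (*-distribˡ-sumℤ n s X)) ⟩
  Q - s * s                                                     ∎
  where
  open ≡-Reasoning
  s = sumℤ n X
  Q = sumℤ n (λ i → X i * (y i * X i))
  l : ∀ x a s → x * (a * x - s) ≡ x * (a * x) + - (s * x)
  l = solve-∀

-- (Σ Xᵢ)² ≤ (Σ 1/yᵢ)(Σ yᵢXᵢ²) multiplied by ∏ y: Cauchy–Schwarz with weights prodExcept y i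
-- and zᵢ = yᵢXᵢ.
sumℤ²≤-Diag−J : ∀ n (y X : Vecℤ n) → (∀ i → 0ℤ <ℤ y i) →
  prodℤ n y * (sumℤ n X * sumℤ n X) ≤ℤ sumℤ n (prodExcept y) * sumℤ n (λ i → X i * (y i * X i))
sumℤ²≤-Diag−J n y X y>0 = ℤP.*-cancelˡ-≤-pos (P * (s * s)) (W * Q) P {{ℤ.positive (prodℤ-pos n y y>0)}} (begin
  P * (P * (s * s))        ≡⟨ l₁ P s ⟩
  (P * s) * (P * s)        ≡⟨ sym (cong₂ _*_ L≡Ps L≡Ps) ⟩
  L * L                    ≤⟨ weighted-cauchy-schwarz n w (λ i → y i * X i) (λ i → ℤP.<⇒≤ (prodExcept-pos y y>0 i)) ⟩
  W * A                    ≡⟨ cong (W *_) A≡PQ ⟩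
  W * (P * Q)              ≡⟨ l₂ W P Q ⟩
  P * (W * Q)              ∎)
  where
  open ℤP.≤-Reasoning
  P = prodℤ n y
  w = prodExcept y
  W = sumℤ n w
  s = sumℤ n X
  Q = sumℤ n (λ i → X i * (y i * X i))
  L = sumℤ n (λ i → w i * (y i * X i))
  A = sumℤ n (λ i → w i * ((y i * X i) * (y i * X i)))
  L≡Ps : L ≡ P * s
  L≡Ps = trans (sumℤ-cong n λ i → trans (l (w i) (y i) (X i)) (cong (_* X i) (prodExcept-* y i)))
               (sym (*-distribˡ-sumℤ n P X))
    where l : ∀ w a x → w * (a * x) ≡ (a * w) * x
          l = solve-∀
  A≡PQ : A ≡ P * Q
  A≡PQ = trans (sumℤ-cong n λ i → trans (l (w i) (y i) (X i)) (cong (λ p → p * (X i * (y i * X i))) (prodExcept-* y i)))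
               (sym (*-distribˡ-sumℤ n P _))
    where l : ∀ w a x → w * ((a * x) * (a * x)) ≡ (a * w) * (x * (a * x))
          l = solve-∀
  l₁ : ∀ p s → p * (p * (s * s)) ≡ (p * s) * (p * s)
  l₁ = solve-∀
  l₂ : ∀ w p q → w * (p * q) ≡ p * (w * q)
  l₂ = solve-∀

Diag−J-posDef : ∀ n (y : Vecℤ n) → (∀ i → 0ℤ <ℤ y i) → 0ℤ <ℤ det n (Diag−J y) → PosDef (Diag−J y)
Diag−J-posDef n y y>0 D>0 X (c , Xc≢0) = subst (0ℤ <ℤ_) (sym (quad-Diag−J n y X))
  (ℤP.*-cancelˡ-<-nonNeg P {{ℤ.nonNegative (ℤP.<⇒≤ (prodℤ-pos n y y>0))}} (begin-strict
    P * 0ℤ                ≡⟨ ℤP.*-zeroʳ P ⟩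
    0ℤ                    <⟨ *-pos D>0 Q>0 ⟩
    D * Q                 ≡⟨ l₁ P D Q ⟩
    P * Q - (P - D) * Q   ≡⟨ cong (λ t → P * Q - t * Q) (sym W≡P-D) ⟩
    P * Q - W * Q         ≤⟨ ℤP.+-monoʳ-≤ (P * Q) (ℤP.neg-mono-≤ (sumℤ²≤-Diag−J n y X y>0)) ⟩
    P * Q - P * (s * s)   ≡⟨ l₂ P Q s ⟩
    P * (Q - s * s)       ∎))
  where
  open ℤP.≤-Reasoning
  P = prodℤ n y
  D = det n (Diag−J y)
  W = sumℤ n (prodExcept y)
  Q = sumℤ n (λ i → X i * (y i * X i))
  s = sumℤ n X
  W≡P-D : W ≡ P - D
  W≡P-D = trans (sym (l P W)) (cong (λ t → P - t) (sym (det-Diag−J n y)))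
    where l : ∀ p w → p - (p - w) ≡ w
          l = solve-∀
  term : ∀ i → X i * (y i * X i) ≡ y i * (X i * X i)
  term i = l (X i) (y i)
    where l : ∀ x a → x * (a * x) ≡ a * (x * x)
          l = solve-∀
  Q>0 : 0ℤ <ℤ Q
  Q>0 = sumℤ-pos n _ c (λ i → subst (0ℤ ≤ℤ_) (sym (term i)) (*-nonNeg (ℤP.<⇒≤ (y>0 i)) (square-nonNeg (X i))))
    (subst (0ℤ <ℤ_) (sym (term c)) (*-pos (y>0 c) (square-pos Xc≢0)))
  l₁ : ∀ p d q → d * q ≡ p * q - (p - d) * q
  l₁ = solve-∀
  l₂ : ∀ p q s → p * q - p * (s * s) ≡ p * (q - s * s)
  l₂ = solve-∀

*-sumℤ-prodExcept₂ : ∀ n (y f : Vecℤ n) i →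
  y i * sumℤ n (λ k → prodExcept₂ y i k * f k) ≡ sumℤ n (λ k → prodExcept y k * f k) + (prodℤ n y - prodExcept y i) * f i
*-sumℤ-prodExcept₂ n y f i = begin
  y i * sumℤ n (λ k → u k * f k)                    ≡⟨ *-distribˡ-sumℤ n (y i) _ ⟩
  sumℤ n (λ k → y i * (u k * f k))                  ≡⟨ sumℤ-cong n (λ k → sym (l₁ (w k * f k) _)) ⟩
  sumℤ n (λ k → w k * f k + excess k)               ≡⟨ sumℤ-distrib-+ n _ excess ⟩
  sumℤ n (λ k → w k * f k) + sumℤ n excess          ≡⟨ cong (λ t → sumℤ n (λ k → w k * f k) + t) (sumℤ-single n excess i excess-off) ⟩
  sumℤ n (λ k → w k * f k) + excess i               ≡⟨ cong (λ t → sumℤ n (λ k → w k * f k) + t) excess-at ⟩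
  sumℤ n (λ k → w k * f k) + (P - w i) * f i        ∎
  where
  open ≡-Reasoning
  P = prodℤ n y
  w = prodExcept y
  u = prodExcept₂ y i
  excess : Vecℤ n
  excess k = y i * (u k * f k) - w k * f k
  l₁ : ∀ a b → a + (b - a) ≡ b
  l₁ = solve-∀
  excess-off : ∀ k → k ≢ i → excess k ≡ 0ℤ
  excess-off k k≢i = trans (cong (_- w k * f k) (trans (sym (ℤP.*-assoc (y i) _ _)) (cong (_* f k) (*-prodExcept₂ y k≢i))))
                           (ℤP.+-inverseʳ (w k * f k))
  excess-at : excess i ≡ (P - w i) * f i
  excess-at = begin
    y i * (u i * f i) - w i * f i    ≡⟨ cong (λ v → y i * (v * f i) - w i * f i) (prodExcept₂-diagonal y i) ⟩
    y i * (w i * f i) - w i * f i    ≡⟨ l₂ (y i) (w i) (f i) ⟩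
    (y i * w i - w i) * f i          ≡⟨ cong (λ p → (p - w i) * f i) (prodExcept-* y i) ⟩
    (P - w i) * f i                  ∎
    where l₂ : ∀ a b c → a * (b * c) - b * c ≡ (a * b - b) * c
          l₂ = solve-∀

-- Yᵢ = (xᵢ + Σₖ wₖxₖ) / yᵢ with wₖ = prodExcept y k, computed without division:
-- yᵢ · prodExcept₂ y i k = wₖ for k ≠ i.
Diag−J-preimage : ∀ {n} → Vecℤ n → Vecℤ n → Vecℤ n
Diag−J-preimage {n} y x i = U x + (prodExcept y i - U (λ _ → 1ℤ)) * x i
  where
  U : Vecℤ n → ℤ
  U f = sumℤ n (λ k → prodExcept₂ y i k * f k)

*-Diag−J-preimage : ∀ n (y x : Vecℤ n) → det n (Diag−J y) ≡ 1ℤ →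
  ∀ i → y i * Diag−J-preimage y x i ≡ x i + sumℤ n (λ k → prodExcept y k * x k)
*-Diag−J-preimage n y x det≡1 i = begin
  y i * (U x + (w i - U 1s) * x i)                                   ≡⟨ l₁ (y i) (U x) (w i) (U 1s) (x i) ⟩
  y i * U x + (y i * w i - y i * U 1s) * x i                         ≡⟨ cong₂ (λ a b → a + b * x i) (*-sumℤ-prodExcept₂ n y x i)
                                                                          (cong₂ _-_ (prodExcept-* y i) (*-sumℤ-prodExcept₂ n y 1s i)) ⟩
  T + (P - w i) * x i + (P - (S₁ + (P - w i) * 1ℤ)) * x i            ≡⟨ cong (λ t → T + (P - w i) * x i + (P - (t + (P - w i) * 1ℤ)) * x i) S₁≡S ⟩
  T + (P - w i) * x i + (P - (S + (P - w i) * 1ℤ)) * x i             ≡⟨ l₂ T P (w i) S (x i) ⟩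
  (P - S) * x i + T                                                  ≡⟨ cong (λ d → d * x i + T) P-S≡1 ⟩
  1ℤ * x i + T                                                       ≡⟨ cong (_+ T) (ℤP.*-identityˡ (x i)) ⟩
  x i + T                                                            ∎
  where
  open ≡-Reasoning
  P = prodℤ n y
  w = prodExcept y
  S = sumℤ n w
  T = sumℤ n (λ k → w k * x k)
  1s : Vecℤ n
  1s _ = 1ℤ
  U : Vecℤ n → ℤ
  U f = sumℤ n (λ k → prodExcept₂ y i k * f k)
  S₁ = sumℤ n (λ k → w k * 1ℤ)
  S₁≡S : S₁ ≡ S
  S₁≡S = sumℤ-cong n (λ k → ℤP.*-identityʳ (w k))
  P-S≡1 : P - S ≡ 1ℤ
  P-S≡1 = trans (sym (det-Diag−J n y)) det≡1
  l₁ : ∀ a v b c z → a * (v + (b - c) * z) ≡ a * v + (a * b - a * c) * z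
  l₁ = solve-∀
  l₂ : ∀ t p b s z → t + (p - b) * z + (p - (s + (p - b) * 1ℤ)) * z ≡ (p - s) * z + t
  l₂ = solve-∀

sumℤ-Diag−J-preimage : ∀ n (y x : Vecℤ n) → prodℤ n y ≢ 0ℤ → det n (Diag−J y) ≡ 1ℤ →
  sumℤ n (Diag−J-preimage y x) ≡ sumℤ n (λ k → prodExcept y k * x k)
sumℤ-Diag−J-preimage n y x P≢0 det≡1 = ℤP.*-cancelˡ-≡ P (sumℤ n Y) T {{ℤ.≢-nonZero P≢0}} (begin
  P * sumℤ n Y                          ≡⟨ *-distribˡ-sumℤ n P Y ⟩
  sumℤ n (λ i → P * Y i)                ≡⟨ sumℤ-cong n (λ i → trans (cong (_* Y i) (sym (prodExcept-* y i)))
                                             (trans (l₁ (y i) (w i) (Y i)) (cong (w i *_) (*-Diag−J-preimage n y x det≡1 i)))) ⟩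
  sumℤ n (λ i → w i * (x i + T))        ≡⟨ sumℤ-cong n (λ i → ℤP.*-distribˡ-+ (w i) (x i) T) ⟩
  sumℤ n (λ i → w i * x i + w i * T)    ≡⟨ sumℤ-distrib-+ n _ _ ⟩
  T + sumℤ n (λ i → w i * T)            ≡⟨ cong (λ t → T + t) (sumℤ-cong n (λ i → ℤP.*-comm (w i) T)) ⟩
  T + sumℤ n (λ i → T * w i)            ≡⟨ cong (λ t → T + t) (sym (*-distribˡ-sumℤ n T w)) ⟩
  T + T * S                             ≡⟨ l₂ T P S ⟩
  P * T - (P - S) * T + T               ≡⟨ cong (λ d → P * T - d * T + T) (trans (sym (det-Diag−J n y)) det≡1) ⟩
  P * T - 1ℤ * T + T                    ≡⟨ l₃ P T ⟩
  P * T                                 ∎)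
  where
  open ≡-Reasoning
  P = prodℤ n y
  w = prodExcept y
  S = sumℤ n w
  T = sumℤ n (λ k → w k * x k)
  Y = Diag−J-preimage y x
  l₁ : ∀ a b c → (a * b) * c ≡ b * (a * c)
  l₁ = solve-∀
  l₂ : ∀ t p s → t + t * s ≡ p * t - (p - s) * t + t
  l₂ = solve-∀
  l₃ : ∀ p t → p * t - 1ℤ * t + t ≡ p * t
  l₃ = solve-∀

Diag−J-surjective : ∀ n (y : Vecℤ n) → prodℤ n y ≢ 0ℤ → det n (Diag−J y) ≡ 1ℤ → ∀ x → InImage (Diag−J y) x
Diag−J-surjective n y P≢0 det≡1 x = Y , λ i → sym (begin
  (Diag−J y · Y) i           ≡⟨ Diag−J-· n y Y i ⟩
  y i * Y i - sumℤ n Y       ≡⟨ cong₂ _-_ (*-Diag−J-preimage n y x det≡1 i) (sumℤ-Diag−J-preimage n y x P≢0 det≡1) ⟩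
  (x i + T) - T              ≡⟨ l (x i) T ⟩
  x i                        ∎)
  where
  open ≡-Reasoning
  Y = Diag−J-preimage y x
  T = sumℤ n (λ k → prodExcept y k * x k)
  l : ∀ a t → (a + t) - t ≡ a
  l = solve-∀

surjective⇒cyclicΦ : ∀ {n} (M : Matrix n) → (∀ x → InImage M x) → CyclicΦ M
surjective⇒cyclicΦ M onto = (λ _ → 0ℤ) , (1ℤ , (λ ()) , onto _) , λ x _ → 0ℤ , onto _

proposition7p1 : (n : ℕ) → 2 ≤ n →
    InV (completeAdj n) (+ 2) 1 ⇔
      (∃ λ (y : Vecℤ n) → (∀ i → + 3 ≤ℤ y i) ×
        (sumℚ n (λ i → recip (y i)) +ℚ recip (prodℤ n y) ≡ 1ℚ))
proposition7p1 n _ = mk⇔ forward backward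
  where
  Solution : Set
  Solution = ∃ λ (y : Vecℤ n) → (∀ i → + 3 ≤ℤ y i) × (sumℚ n (λ i → recip (y i)) +ℚ recip (prodℤ n y) ≡ 1ℚ)
  3≤⇒0< : ∀ {z} → + 3 ≤ℤ z → 0ℤ <ℤ z
  3≤⇒0< = ℤP.<-≤-trans (+<+ (s≤s z≤n))
  forward : InV (completeAdj n) (+ 2) 1 → Solution
  forward (a , a≥2 , 1≡det , _) =
    y , y≥3 , Equivalence.from (egyptian⇔det-Diag−J≡1 n y (3≤⇒0< ∘ y≥3)) det≡1
    where
    y : Vecℤ n
    y k = a k + 1ℤ
    y≥3 : ∀ i → + 3 ≤ℤ y i
    y≥3 i = ℤP.+-monoˡ-≤ 1ℤ (a≥2 i)
    det≡1 : det n (Diag−J y) ≡ 1ℤ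
    det≡1 = trans (det-cong n (MG-cong (completeAdj n) (λ k → l (a k)))) (sym 1≡det)
      where l : ∀ b → b + 1ℤ - 1ℤ ≡ b
            l = solve-∀
  backward : Solution → InV (completeAdj n) (+ 2) 1
  backward (y , y≥3 , egyptian) =
    (λ k → y k - 1ℤ) , (λ i → ℤP.+-monoˡ-≤ -1ℤ (y≥3 i)) , sym det≡1 ,
    Diag−J-posDef n y y>0 (subst (0ℤ <ℤ_) (sym det≡1) (+<+ (s≤s z≤n))) ,
    surjective⇒cyclicΦ (Diag−J y) (Diag−J-surjective n y (≢-sym (ℤP.<⇒≢ (prodℤ-pos n y y>0))) det≡1)
    where
    y>0 : ∀ i → 0ℤ <ℤ y i
    y>0 = 3≤⇒0< ∘ y≥3
    det≡1 : det n (Diag−J y) ≡ 1ℤ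
    det≡1 = Equivalence.to (egyptian⇔det-Diag−J≡1 n y y>0) egyptian
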